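{- There is an absolute constant $c>0$ such that, in the setting of the context, for every sparse vertex $v$ and every color $c'\notin\operatorname{Pal}(v)$, the probability that $c'$ is good for $v$ is at least $c\,|N_{c'}(v)|/\Delta$.
   Context: Let $G=(V,E)$ be a finite simple graph with maximum degree $\Delta\ge1$ and neighborhoods $N(v)$. Each vertex $v$ has a palette $\operatorname{Pal}(v)$ of exactly $\Delta+1$ colors; $0$ is a blank color. Fix $\epsilon\in(0,1/5)$. An edge $uv$ is a friend edge if $|N(u)\cap N(v)|\ge(1-\epsilon)\Delta$; a vertex is sparse if it has fewer than $(1-\epsilon)\Delta$ friends. $N_c(v)=\{w\in N(v): c\in\operatorname{Pal}(w)\}$. Initial coloring step: independently, each vertex sets $A(v)=0$ with probability $99/100$ and otherwise chooses $A(v)$ uniformly from $\operatorname{Pal}(v)$; then $\chi(v)=A(v)$ if $A(v)\ne0$ and no neighbor $w$ has $A(w)=A(v)$, else $\chi(v)=0$. A color $c\ne0$ is good for $v$ if $|\{w\in N(v):\chi(w)=c\}|\ge1+[c\in\operatorname{Pal}(v)]$, where $[P]$ is $1$ if $P$ holds and $0$ otherwise. -}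

module Defs where

open import Data.Bool using (Bool; true; false; _∧_; if_then_else_)
open import Data.Nat as ℕ using (ℕ; zero; suc; _⊔_)
open import Data.Integer using (+_)
open import Data.Fin using (Fin)
open import Data.Maybe using (Maybe; nothing; just)
open import Data.List using (List; []; _∷_; map; foldr; concatMap; allFin)
open import Data.Vec as Vec using (Vec; []; _∷_; lookup)
open import Data.Vec.Membership.DecPropositional ℕ._≟_ using (_∈?_)
open import Data.Rational as ℚ using (ℚ; _/_; 0ℚ; 1ℚ)
open import Relation.Nullary using (does; ¬_)
open import Relation.Binary.PropositionalEquality using (_≡_)

toℚ : ℕ → ℚ
toℚ k = + k / 1

count : ∀ {n} → (Fin n → Bool) → ℕ
count {n} p = foldr (λ i acc → (if p i then 1 else 0) ℕ.+ acc) 0 (allFin n)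

record SimpleGraph (n : ℕ) : Set where
  field
    adj   : Fin n → Fin n → Bool
    sym   : ∀ u v → adj u v ≡ adj v u
    loopless : ∀ v → adj v v ≡ false

open SimpleGraph public

degree : ∀ {n} → SimpleGraph n → Fin n → ℕ
degree G v = count (adj G v)

maxDegree : ∀ {n} → SimpleGraph n → ℕ
maxDegree {n} G = foldr (λ v m → degree G v ⊔ m) 0 (allFin n)

commonNbrs : ∀ {n} → SimpleGraph n → Fin n → Fin n → ℕ
commonNbrs G u v = count (λ w → adj G u w ∧ adj G v w)

isFriend : ∀ {n} → SimpleGraph n → ℕ → ℚ → Fin n → Fin n → Bool
isFriend G Δ ε u v =
  adj G u v ∧ does (((1ℚ ℚ.- ε) ℚ.* toℚ Δ) ℚ.≤? toℚ (commonNbrs G u v))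

Sparse : ∀ {n} → SimpleGraph n → ℕ → ℚ → Fin n → Set
Sparse G Δ ε v = toℚ (count (isFriend G Δ ε v)) ℚ.< (1ℚ ℚ.- ε) ℚ.* toℚ Δ

-- Palettes: each vertex gets a vector of Δ+1 distinct nonzero colors (colors are ℕ, 0 = blank)
Palettes : ℕ → ℕ → Set
Palettes n Δ = Fin n → Vec ℕ (suc Δ)

inPal : ∀ {n Δ} → Palettes n Δ → ℕ → Fin n → Bool
inPal Pal c v = does (c ∈? Pal v)

Nc : ∀ {n Δ} → SimpleGraph n → Palettes n Δ → ℕ → Fin n → ℕ
Nc G Pal c v = count (λ w → adj G v w ∧ inPal Pal c w)

-- Outcome of the random choice at one vertex: nothing = blank (A(v)=0),
-- just i = the i-th color of Pal(v).
Choice : ℕ → Set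
Choice Δ = Maybe (Fin (suc Δ))


allVecs : ∀ {A : Set} → List A → (n : ℕ) → List (Vec A n)
allVecs xs zero = [] ∷ []
allVecs xs (suc n) = concatMap (λ x → map (x ∷_) (allVecs xs n)) xs

choices : (Δ : ℕ) → List (Choice Δ)
choices Δ = nothing ∷ map just (allFin (suc Δ))

weight : (Δ : ℕ) → Choice Δ → ℚ
weight Δ nothing  = + 99 / 100
weight Δ (just _) = + 1 / (100 ℕ.* suc Δ)

Assignment : ℕ → ℕ → Set
Assignment n Δ = Vec (Choice Δ) n

prob : ∀ {n} Δ → Assignment n Δ → ℚ
prob Δ σ = Vec.foldr _ (λ x acc → weight Δ x ℚ.* acc) 1ℚ σ

Aval : ∀ {n Δ} → Palettes n Δ → Assignment n Δ → Fin n → ℕ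
Aval Pal σ v with lookup σ v
... | nothing = 0
... | just i  = lookup (Pal v) i

χ : ∀ {n Δ} → SimpleGraph n → Palettes n Δ → Assignment n Δ → Fin n → ℕ
χ G Pal σ v with Aval Pal σ v ℕ.≟ 0
... | Relation.Nullary.yes _ = 0
... | Relation.Nullary.no _ =
  if does (count (λ w → adj G v w ∧ does (Aval Pal σ w ℕ.≟ Aval Pal σ v)) ℕ.≟ 0)
  then Aval Pal σ v else 0

isGood : ∀ {n Δ} → SimpleGraph n → Palettes n Δ → Assignment n Δ → ℕ → Fin n → Bool
isGood G Pal σ c v with c ℕ.≟ 0
... | Relation.Nullary.yes _ = false
... | Relation.Nullary.no _ =
  does ((1 ℕ.+ (if inPal Pal c v then 1 else 0))
        ℕ.≤? count (λ w → adj G v w ∧ does (χ G Pal σ w ℕ.≟ c)))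

Pr : (n Δ : ℕ) → (Assignment n Δ → Bool) → ℚ
Pr n Δ E = foldr (λ σ acc → (if E σ then prob Δ σ else 0ℚ) ℚ.+ acc) 0ℚ
                 (allVecs (choices Δ) n)

-- Write p = 1/(100(Δ+1)) for the probability that a vertex proposes a given colour of its palette.
-- As c ∉ Pal(v), the colour c is good for v as soon as a single neighbour keeps c. Call w ∈ N_c(v) a
-- winner if w proposes c while no other vertex of N_c(v) ∪ N(w) does: a winner keeps c, and two
-- distinct vertices of N_c(v) cannot both win, so Pr(c good) ≥ Σ_w Pr(w wins). The choices are
-- independent, so Pr(w wins) is a product of one factor per vertex, at least p for w itself and at
-- least 1 − p for each of its at most 2Δ rivals; by the Weierstrass product inequality it is at least
-- p(1 − 2Δp). Since 1/200 ≤ Δp ≤ 1/100, this gives Δ · Pr(c good) ≥ |N_c(v)| · Δp(1 − 2Δp) ≥ |N_c(v)|/1000.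

module Submission where

open import Defs hiding (sym)
open import Data.Nat as ℕ using (ℕ; suc; zero)
open import Data.Fin using (Fin)
open import Data.Vec using (lookup)
open import Data.Vec.Membership.Propositional using (_∉_)
open import Data.Rational using (ℚ; _<_; _≤_; _*_; _/_; 0ℚ)
open import Data.Integer using (+_)
open import Data.Product using (∃; _×_)
open import Relation.Binary.PropositionalEquality using (_≡_; _≢_)

open import Data.Bool using (Bool; true; false; _∧_; _∨_; not; if_then_else_)
open import Data.Bool.Properties using (not-injective; ∨-zeroʳ)
open import Data.Empty using (⊥-elim)
open import Data.Fin as Fin using (zero; suc; punchIn)
open import Data.Fin.Properties using (suc-injective; punchInᵢ≢i)
import Data.Integer as ℤ
import Data.Integer.Properties as ℤₚ
open import Data.List as List using (List; []; _∷_; _++_; concatMap)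
open import Data.Maybe using (nothing; just)
import Data.Nat.Coprimality as Coprime
import Data.Nat.Properties as ℕₚ
open import Data.Product using (_,_)
open import Data.Rational as ℚ using (mkℚ; toℚᵘ; _+_; _-_; -_; 1ℚ)
open import Data.Rational.Properties
open import Data.Rational.Solver using (module +-*-Solver)
import Data.Rational.Unnormalised as ℚᵘ
import Data.Rational.Unnormalised.Properties as ℚᵘ
open import Data.Unit using (tt)
open import Data.Vec using ([]; _∷_)
open import Data.Vec.Functional using (removeAt)
open import Data.Vec.Membership.Propositional using (_∈_)
open import Data.Vec.Membership.DecPropositional ℕ._≟_ using (_∈?_)
import Data.Vec.Relation.Unary.Any as Any
open import Data.Vec.Relation.Unary.Any.Properties using (lookup-index)
open import Function using (_∘_; id; case_of_)
open import Relation.Binary.PropositionalEquality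
  using (refl; sym; trans; cong; cong₂; subst; subst₂; module ≡-Reasoning)
open import Relation.Nullary using (Dec; yes; no; does; ¬_)
open import Relation.Nullary.Decidable using (dec-true; dec-false; toWitness)

open +-*-Solver
open import Algebra.Properties.CommutativeMonoid.Sum +-0-commutativeMonoid using (sum; sum-remove)
open import Algebra.Properties.CommutativeMonoid.Sum *-1-commutativeMonoid
  using () renaming (sum to prod; sum-remove to prod-remove)

∧-trueˡ : ∀ {a b} → a ∧ b ≡ true → a ≡ true
∧-trueˡ {true} _ = refl

∧-trueʳ : ∀ {a b} → a ∧ b ≡ true → b ≡ true
∧-trueʳ {true} a∧b = a∧b

does-true⇒ : ∀ {P : Set} (P? : Dec P) → does P? ≡ true → P
does-true⇒ (yes p) _ = p

does-false⇒ : ∀ {P : Set} (P? : Dec P) → does P? ≡ false → ¬ P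
does-false⇒ (no ¬p) _ = ¬p

-- Rational arithmetic

toℚ≡mkℚ : ∀ k → toℚ k ≡ mkℚ (+ k) 0 (Coprime.sym (Coprime.1-coprimeTo k))
toℚ≡mkℚ k = normalize-coprime (Coprime.sym (Coprime.1-coprimeTo k))

toℚ-suc : ∀ k → toℚ (suc k) ≡ 1ℚ + toℚ k
toℚ-suc k = toℚᵘ-injective (ℚᵘ.≃-trans (ℚᵘ.≃-reflexive (cong toℚᵘ (toℚ≡mkℚ (suc k))))
                           (ℚᵘ.≃-trans unnormalised (ℚᵘ.≃-sym (toℚᵘ-homo-+ 1ℚ (toℚ k)))))
  where
  unnormalised : ℚᵘ.mkℚᵘ (+ suc k) 0 ℚᵘ.≃ toℚᵘ 1ℚ ℚᵘ.+ toℚᵘ (toℚ k)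
  unnormalised rewrite toℚ≡mkℚ k | ℕₚ.*-identityʳ k | ℤₚ.+◃n≡+n k = ℚᵘ.*≡* refl

toℚ-+ : ∀ a b → toℚ (a ℕ.+ b) ≡ toℚ a + toℚ b
toℚ-+ zero    b = sym (+-identityˡ (toℚ b))
toℚ-+ (suc a) b = begin
  toℚ (suc (a ℕ.+ b))   ≡⟨ toℚ-suc (a ℕ.+ b) ⟩
  1ℚ + toℚ (a ℕ.+ b)    ≡⟨ cong (λ z → 1ℚ + z) (toℚ-+ a b) ⟩
  1ℚ + (toℚ a + toℚ b)  ≡⟨ sym (+-assoc 1ℚ (toℚ a) (toℚ b)) ⟩
  (1ℚ + toℚ a) + toℚ b  ≡⟨ cong (_+ toℚ b) (sym (toℚ-suc a)) ⟩
  toℚ (suc a) + toℚ b   ∎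
  where open ≡-Reasoning

toℚ-* : ∀ a b → toℚ (a ℕ.* b) ≡ toℚ a * toℚ b
toℚ-* zero    b = sym (*-zeroˡ (toℚ b))
toℚ-* (suc a) b = begin
  toℚ (b ℕ.+ a ℕ.* b)    ≡⟨ toℚ-+ b (a ℕ.* b) ⟩
  toℚ b + toℚ (a ℕ.* b)  ≡⟨ cong (λ z → toℚ b + z) (toℚ-* a b) ⟩
  toℚ b + toℚ a * toℚ b  ≡⟨ solve 2 (λ x y → y :+ x :* y := (con 1ℚ :+ x) :* y) refl (toℚ a) (toℚ b) ⟩
  (1ℚ + toℚ a) * toℚ b   ≡⟨ cong (_* toℚ b) (sym (toℚ-suc a)) ⟩
  toℚ (suc a) * toℚ b    ∎
  where open ≡-Reasoning

toℚ-nonNeg : ∀ k → 0ℚ ≤ toℚ k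
toℚ-nonNeg k = nonNegative⁻¹ (toℚ k) {{normalize-nonNeg k 1}}

toℚ-mono-≤ : ∀ {a b} → a ℕ.≤ b → toℚ a ≤ toℚ b
toℚ-mono-≤ {b = b} ℕ.z≤n = toℚ-nonNeg b
toℚ-mono-≤ {suc a} {suc b} (ℕ.s≤s a≤b) =
  subst₂ _≤_ (sym (toℚ-suc a)) (sym (toℚ-suc b)) (+-monoʳ-≤ 1ℚ (toℚ-mono-≤ a≤b))

toℚ*1/≡1 : ∀ m .{{_ : ℕ.NonZero m}} → toℚ m * (+ 1 / m) ≡ 1ℚ
toℚ*1/≡1 (suc j) = trans (cong₂ _*_ (toℚ≡mkℚ (suc j)) (normalize-coprime (Coprime.1-coprimeTo (suc j))))
                         (*-inverseʳ (mkℚ (+ suc j) 0 (Coprime.sym (Coprime.1-coprimeTo (suc j)))))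

*-nonNeg : ∀ {a b} → 0ℚ ≤ a → 0ℚ ≤ b → 0ℚ ≤ a * b
*-nonNeg {a} {b} 0≤a 0≤b =
  nonNegative⁻¹ (a * b) {{nonNeg*nonNeg⇒nonNeg a {{ℚ.nonNegative 0≤a}} b {{ℚ.nonNegative 0≤b}}}}

*-monoˡ-≤-≥0 : ∀ {r a b} → 0ℚ ≤ r → a ≤ b → r * a ≤ r * b
*-monoˡ-≤-≥0 {r} 0≤r = *-monoˡ-≤-nonNeg r {{ℚ.nonNegative 0≤r}}

*-monoʳ-≤-≥0 : ∀ {r a b} → 0ℚ ≤ r → a ≤ b → a * r ≤ b * r
*-monoʳ-≤-≥0 {r} 0≤r = *-monoʳ-≤-nonNeg r {{ℚ.nonNegative 0≤r}}

1-antimono-≤ : ∀ {a b} → a ≤ b → 1ℚ - b ≤ 1ℚ - a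
1-antimono-≤ a≤b = +-monoʳ-≤ 1ℚ (neg-antimono-≤ a≤b)

p≤1⇒0≤1-p : ∀ {a} → a ≤ 1ℚ → 0ℚ ≤ 1ℚ - a
p≤1⇒0≤1-p {a} a≤1 = ≤-trans (≤-reflexive (sym (+-inverseʳ a))) (+-monoˡ-≤ (- a) a≤1)

p≤p+q : ∀ {a b} → 0ℚ ≤ b → a ≤ a + b
p≤p+q {a} 0≤b = ≤-trans (≤-reflexive (sym (+-identityʳ a))) (+-monoʳ-≤ a 0≤b)

if-≤ : ∀ t {a b} → (t ≡ true → a ≤ b) → 0ℚ ≤ b → (if t then a else 0ℚ) ≤ b
if-≤ true  a≤b _   = a≤b refl
if-≤ false _   0≤b = 0≤b

-- Counting vertices

count′ : ∀ {n} → (Fin n → Bool) → ℕ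
count′ {zero}  p = 0
count′ {suc n} p = (if p zero then 1 else 0) ℕ.+ count′ (p ∘ suc)

count-tabulate : ∀ {m} n (g : Fin n → Fin m) (p : Fin m → Bool) →
  List.foldr (λ i acc → (if p i then 1 else 0) ℕ.+ acc) 0 (List.tabulate g) ≡ count′ (p ∘ g)
count-tabulate zero    g p = refl
count-tabulate (suc n) g p = cong ((if p (g zero) then 1 else 0) ℕ.+_) (count-tabulate n (g ∘ suc) p)

count≡count′ : ∀ {n} (p : Fin n → Bool) → count p ≡ count′ p
count≡count′ {n} p = count-tabulate n id p

count′-zero : ∀ {n} (p : Fin n → Bool) → (∀ i → p i ≡ false) → count′ p ≡ 0
count′-zero {zero}  p _       = refl
count′-zero {suc n} p p≡false rewrite p≡false zero = count′-zero (p ∘ suc) (p≡false ∘ suc)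

count′-pos : ∀ {n} (p : Fin n → Bool) i → p i ≡ true → 1 ℕ.≤ count′ p
count′-pos p zero    pi≡true rewrite pi≡true = ℕ.s≤s ℕ.z≤n
count′-pos p (suc i) pi≡true = ℕₚ.≤-trans (count′-pos (p ∘ suc) i pi≡true) (ℕₚ.m≤n+m _ _)

count′-≤1 : ∀ {n} (p : Fin n → Bool) → (∀ i j → p i ≡ true → p j ≡ true → i ≡ j) → count′ p ℕ.≤ 1
count′-≤1 {zero}  p _    = ℕ.z≤n
count′-≤1 {suc n} p uniq with p zero in p0
... | true  = ℕₚ.≤-reflexive (cong suc (count′-zero (p ∘ suc) only-zero))
  where
  only-zero : ∀ i → p (suc i) ≡ false
  only-zero i with p (suc i) in pi
  ... | true  with () ← uniq zero (suc i) p0 pi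
  ... | false = refl
... | false = count′-≤1 (p ∘ suc) (λ i j pi pj → suc-injective (uniq (suc i) (suc j) pi pj))

count′-mono : ∀ {n} (p q : Fin n → Bool) → (∀ i → p i ≡ true → q i ≡ true) → count′ p ℕ.≤ count′ q
count′-mono {zero}  p q _   = ℕ.z≤n
count′-mono {suc n} p q p⊆q with p zero in p0
... | true  rewrite p⊆q zero p0 = ℕ.s≤s (count′-mono (p ∘ suc) (q ∘ suc) (p⊆q ∘ suc))
... | false = ℕₚ.≤-trans (count′-mono (p ∘ suc) (q ∘ suc) (p⊆q ∘ suc)) (ℕₚ.m≤n+m _ _)

count′-∨ : ∀ {n} (p q : Fin n → Bool) → count′ (λ i → p i ∨ q i) ℕ.≤ count′ p ℕ.+ count′ q
count′-∨ {zero}  p q = ℕ.z≤n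
count′-∨ {suc n} p q with count′-∨ (p ∘ suc) (q ∘ suc) | p zero | q zero
... | ih | true  | true  = ℕ.s≤s (ℕₚ.≤-trans ih (ℕₚ.+-monoʳ-≤ (count′ (p ∘ suc)) (ℕₚ.n≤1+n _)))
... | ih | true  | false = ℕ.s≤s ih
... | ih | false | true  = ℕₚ.≤-trans (ℕ.s≤s ih) (ℕₚ.≤-reflexive (sym (ℕₚ.+-suc (count′ (p ∘ suc)) _)))
... | ih | false | false = ih

count′-true : ∀ n → count′ {n} (λ _ → true) ≡ n
count′-true zero    = refl
count′-true (suc n) = cong suc (count′-true n)

degree≤maxDegree : ∀ {n} (G : SimpleGraph n) v → degree G v ℕ.≤ maxDegree G
degree≤maxDegree {n} G = below-max n id
  where
  below-max : ∀ m (g : Fin m → Fin n) i →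
    degree G (g i) ℕ.≤ List.foldr (λ u d → degree G u ℕ.⊔ d) 0 (List.tabulate g)
  below-max (suc m) g zero    = ℕₚ.m≤m⊔n _ _
  below-max (suc m) g (suc i) = ℕₚ.≤-trans (below-max m (g ∘ suc) i) (ℕₚ.m≤n⊔m (degree G (g zero)) _)

-- Finite sums and products

sum-mono-≤ : ∀ {n} {f g : Fin n → ℚ} → (∀ i → f i ≤ g i) → sum f ≤ sum g
sum-mono-≤ {zero}  _   = ≤-refl
sum-mono-≤ {suc n} f≤g = +-mono-≤ (f≤g zero) (sum-mono-≤ (f≤g ∘ suc))

sum-nonNeg : ∀ {n} {f : Fin n → ℚ} → (∀ i → 0ℚ ≤ f i) → 0ℚ ≤ sum f
sum-nonNeg {zero}  _   = ≤-refl
sum-nonNeg {suc n} 0≤f = +-mono-≤ (0≤f zero) (sum-nonNeg (0≤f ∘ suc))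

sum-removeAt-≤ : ∀ {n} (f : Fin (suc n) → ℚ) i → 0ℚ ≤ f i → sum (removeAt f i) ≤ sum f
sum-removeAt-≤ f i 0≤fi = begin
  sum (removeAt f i)        ≡⟨ sym (+-identityˡ _) ⟩
  0ℚ + sum (removeAt f i)   ≤⟨ +-monoˡ-≤ _ 0≤fi ⟩
  f i + sum (removeAt f i)  ≡⟨ sym (sum-remove f) ⟩
  sum f                     ∎
  where open ≤-Reasoning

sum-if : ∀ {n} (p : Fin n → Bool) a → sum (λ i → if p i then a else 0ℚ) ≡ toℚ (count′ p) * a
sum-if {zero}  p a = sym (*-zeroˡ a)
sum-if {suc n} p a with p zero
... | true  = begin
  a + sum (λ i → if p (suc i) then a else 0ℚ)  ≡⟨ cong (λ z → a + z) (sum-if (p ∘ suc) a) ⟩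
  a + k * a                                     ≡⟨ solve 2 (λ a k → a :+ k :* a := (con 1ℚ :+ k) :* a) refl a k ⟩
  (1ℚ + k) * a                                  ≡⟨ cong (_* a) (sym (toℚ-suc (count′ (p ∘ suc)))) ⟩
  toℚ (suc (count′ (p ∘ suc))) * a              ∎
  where
  open ≡-Reasoning
  k = toℚ (count′ (p ∘ suc))
... | false = trans (+-identityˡ _) (sum-if (p ∘ suc) a)

prod-nonNeg : ∀ {n} {f : Fin n → ℚ} → (∀ i → 0ℚ ≤ f i) → 0ℚ ≤ prod f
prod-nonNeg {zero}  _   = ℚ.*≤* (ℤ.+≤+ ℕ.z≤n)
prod-nonNeg {suc n} 0≤f = *-nonNeg (0≤f zero) (prod-nonNeg (0≤f ∘ suc))

1-sum≤prod : ∀ {n} (x f : Fin n → ℚ) → (∀ i → 0ℚ ≤ x i) → (∀ i → x i ≤ 1ℚ) →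
             (∀ i → 1ℚ - x i ≤ f i) → 1ℚ - sum x ≤ prod f
1-sum≤prod {zero}  x f _   _   _       = ≤-refl
1-sum≤prod {suc n} x f 0≤x x≤1 1-x≤f = begin
  1ℚ - (x₀ + s)
    ≤⟨ p≤p+q (*-nonNeg (0≤x zero) (sum-nonNeg (0≤x ∘ suc))) ⟩
  1ℚ - (x₀ + s) + x₀ * s
    ≡⟨ solve 2 (λ a s → con 1ℚ :- (a :+ s) :+ a :* s := (con 1ℚ :- a) :* (con 1ℚ :- s)) refl x₀ s ⟩
  (1ℚ - x₀) * (1ℚ - s)
    ≤⟨ *-monoˡ-≤-≥0 (p≤1⇒0≤1-p (x≤1 zero))
                    (1-sum≤prod (x ∘ suc) (f ∘ suc) (0≤x ∘ suc) (x≤1 ∘ suc) (1-x≤f ∘ suc)) ⟩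
  (1ℚ - x₀) * P
    ≤⟨ *-monoʳ-≤-≥0 (prod-nonNeg (λ i → ≤-trans (p≤1⇒0≤1-p (x≤1 (suc i))) (1-x≤f (suc i)))) (1-x≤f zero) ⟩
  f zero * P
    ∎
  where
  open ≤-Reasoning
  x₀ = x zero
  s = sum (x ∘ suc)
  P = prod (f ∘ suc)

p*[1-sum]≤prod : ∀ {n} p (x f : Fin n → ℚ) w → 0ℚ ≤ p → p ≤ f w →
                 (∀ i → 0ℚ ≤ x i) → (∀ i → x i ≤ 1ℚ) → (∀ i → i ≢ w → 1ℚ - x i ≤ f i) →
                 p * (1ℚ - sum x) ≤ prod f
p*[1-sum]≤prod {suc n} p x f w 0≤p p≤fw 0≤x x≤1 1-x≤f = begin
  p * (1ℚ - sum x)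
    ≤⟨ *-monoˡ-≤-≥0 0≤p (1-antimono-≤ (sum-removeAt-≤ x w (0≤x w))) ⟩
  p * (1ℚ - sum (removeAt x w))
    ≤⟨ *-monoˡ-≤-≥0 0≤p (1-sum≤prod (removeAt x w) (removeAt f w) (0≤x ∘ punchIn w) (x≤1 ∘ punchIn w) 1-x≤f-rest) ⟩
  p * prod (removeAt f w)
    ≤⟨ *-monoʳ-≤-≥0 (prod-nonNeg (λ i → ≤-trans (p≤1⇒0≤1-p (x≤1 (punchIn w i))) (1-x≤f-rest i))) p≤fw ⟩
  f w * prod (removeAt f w)
    ≡⟨ sym (prod-remove f) ⟩
  prod f
    ∎
  where
  open ≤-Reasoning
  1-x≤f-rest : ∀ i → 1ℚ - x (punchIn w i) ≤ f (punchIn w i)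
  1-x≤f-rest i = 1-x≤f (punchIn w i) (punchInᵢ≢i w i)

private
  variable
    A B : Set

sumList : List A → (A → ℚ) → ℚ
sumList xs f = List.foldr (λ x acc → f x + acc) 0ℚ xs

sumList-cong : ∀ (xs : List A) {f g : A → ℚ} → (∀ x → f x ≡ g x) → sumList xs f ≡ sumList xs g
sumList-cong []       _   = refl
sumList-cong (x ∷ xs) f≗g = cong₂ _+_ (f≗g x) (sumList-cong xs f≗g)

sumList-mono-≤ : ∀ (xs : List A) {f g : A → ℚ} → (∀ x → f x ≤ g x) → sumList xs f ≤ sumList xs g
sumList-mono-≤ []       _   = ≤-refl
sumList-mono-≤ (x ∷ xs) f≤g = +-mono-≤ (f≤g x) (sumList-mono-≤ xs f≤g)

sumList-zero : ∀ (xs : List A) → sumList xs (λ _ → 0ℚ) ≡ 0ℚ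
sumList-zero []       = refl
sumList-zero (x ∷ xs) = cong (λ z → 0ℚ + z) (sumList-zero xs)

sumList-+ : ∀ (xs : List A) (f g : A → ℚ) → sumList xs (λ x → f x + g x) ≡ sumList xs f + sumList xs g
sumList-+ []       f g = refl
sumList-+ (x ∷ xs) f g = trans (cong (λ z → (f x + g x) + z) (sumList-+ xs f g))
  (solve 4 (λ a b c d → (a :+ b) :+ (c :+ d) := (a :+ c) :+ (b :+ d)) refl (f x) (g x) (sumList xs f) (sumList xs g))

sumList-*ˡ : ∀ (xs : List A) a (f : A → ℚ) → sumList xs (λ x → a * f x) ≡ a * sumList xs f
sumList-*ˡ []       a f = sym (*-zeroʳ a)
sumList-*ˡ (x ∷ xs) a f = trans (cong (λ z → a * f x + z) (sumList-*ˡ xs a f)) (sym (*-distribˡ-+ a (f x) _))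

sumList-*ʳ : ∀ (xs : List A) a (f : A → ℚ) → sumList xs (λ x → f x * a) ≡ sumList xs f * a
sumList-*ʳ []       a f = sym (*-zeroˡ a)
sumList-*ʳ (x ∷ xs) a f = trans (cong (λ z → f x * a + z) (sumList-*ʳ xs a f)) (sym (*-distribʳ-+ a (f x) _))

sumList-++ : ∀ (xs ys : List A) (f : A → ℚ) → sumList (xs ++ ys) f ≡ sumList xs f + sumList ys f
sumList-++ []       ys f = sym (+-identityˡ _)
sumList-++ (x ∷ xs) ys f = trans (cong (λ z → f x + z) (sumList-++ xs ys f)) (sym (+-assoc (f x) _ _))

sumList-concatMap : ∀ (g : A → List B) (xs : List A) (f : B → ℚ) →
                    sumList (concatMap g xs) f ≡ sumList xs (λ x → sumList (g x) f)
sumList-concatMap g []       f = refl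
sumList-concatMap g (x ∷ xs) f =
  trans (sumList-++ (g x) (concatMap g xs) f) (cong (λ z → sumList (g x) f + z) (sumList-concatMap g xs f))

sumList-map : ∀ (g : A → B) (xs : List A) (f : B → ℚ) → sumList (List.map g xs) f ≡ sumList xs (f ∘ g)
sumList-map g []       f = refl
sumList-map g (x ∷ xs) f = cong (λ z → f (g x) + z) (sumList-map g xs f)

sumList-tabulate : ∀ {n} (g : Fin n → A) (f : A → ℚ) → sumList (List.tabulate g) f ≡ sum (f ∘ g)
sumList-tabulate {n = zero}  g f = refl
sumList-tabulate {n = suc n} g f = cong (λ z → f (g zero) + z) (sumList-tabulate (g ∘ suc) f)

sumList-sum : ∀ (xs : List A) {n} (h : Fin n → A → ℚ) →
              sumList xs (λ x → sum (λ i → h i x)) ≡ sum (λ i → sumList xs (h i))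
sumList-sum xs {zero}  h = sumList-zero xs
sumList-sum xs {suc n} h = trans (sumList-+ xs (h zero) (λ x → sum (λ i → h (suc i) x)))
                                 (cong (λ z → sumList xs (h zero) + z) (sumList-sum xs (h ∘ suc)))

-- The probability space of the initial colouring step

pickProb : ℕ → ℚ
pickProb Δ = + 1 / (100 ℕ.* suc Δ)

pickProb-nonNeg : ∀ Δ → 0ℚ ≤ pickProb Δ
pickProb-nonNeg Δ = nonNegative⁻¹ _ {{normalize-nonNeg 1 (100 ℕ.* suc Δ)}}

[1+Δ]*pickProb≡1/100 : ∀ Δ → toℚ (suc Δ) * pickProb Δ ≡ + 1 / 100
[1+Δ]*pickProb≡1/100 Δ = begin
  toℚ (suc Δ) * p
    ≡⟨ solve 2 (λ a p → a :* p := con (+ 1 / 100) :* ((con (toℚ 100) :* a) :* p)) refl (toℚ (suc Δ)) p ⟩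
  + 1 / 100 * ((toℚ 100 * toℚ (suc Δ)) * p)
    ≡⟨ cong (λ z → + 1 / 100 * (z * p)) (sym (toℚ-* 100 (suc Δ))) ⟩
  + 1 / 100 * (toℚ (100 ℕ.* suc Δ) * p)
    ≡⟨ cong (λ z → + 1 / 100 * z) (toℚ*1/≡1 (100 ℕ.* suc Δ)) ⟩
  + 1 / 100 * 1ℚ
    ≡⟨ *-identityʳ _ ⟩
  + 1 / 100
    ∎
  where
  open ≡-Reasoning
  p = pickProb Δ

pickProb≤1 : ∀ Δ → pickProb Δ ≤ 1ℚ
pickProb≤1 Δ = begin
  pickProb Δ                ≡⟨ sym (*-identityˡ _) ⟩
  toℚ 1 * pickProb Δ        ≤⟨ *-monoʳ-≤-≥0 (pickProb-nonNeg Δ) (toℚ-mono-≤ (ℕ.s≤s (ℕ.z≤n {Δ}))) ⟩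
  toℚ (suc Δ) * pickProb Δ  ≡⟨ [1+Δ]*pickProb≡1/100 Δ ⟩
  + 1 / 100                 ≤⟨ ℚ.*≤* (ℤ.+≤+ (ℕ.s≤s ℕ.z≤n)) ⟩
  1ℚ                        ∎
  where open ≤-Reasoning

weight-nonNeg : ∀ Δ x → 0ℚ ≤ weight Δ x
weight-nonNeg Δ nothing  = nonNegative⁻¹ _ {{normalize-nonNeg 99 100}}
weight-nonNeg Δ (just _) = pickProb-nonNeg Δ

prob-nonNeg : ∀ {n Δ} (σ : Assignment n Δ) → 0ℚ ≤ prob Δ σ
prob-nonNeg []           = ℚ.*≤* (ℤ.+≤+ ℕ.z≤n)
prob-nonNeg {Δ = Δ} (x ∷ σ) = *-nonNeg (weight-nonNeg Δ x) (prob-nonNeg σ)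

Pr-nonNeg : ∀ n Δ (E : Assignment n Δ → Bool) → 0ℚ ≤ Pr n Δ E
Pr-nonNeg n Δ E = ≤-trans (≤-reflexive (sym (sumList-zero (allVecs (choices Δ) n))))
                          (sumList-mono-≤ (allVecs (choices Δ) n) nonNeg)
  where
  nonNeg : ∀ σ → 0ℚ ≤ (if E σ then prob Δ σ else 0ℚ)
  nonNeg σ with E σ
  ... | true  = prob-nonNeg σ
  ... | false = ≤-refl

prChoice : (Δ : ℕ) → (Choice Δ → Bool) → ℚ
prChoice Δ b = sumList (choices Δ) (λ x → if b x then weight Δ x else 0ℚ)

sumList-choices : ∀ Δ (h : Choice Δ → ℚ) → sumList (choices Δ) h ≡ h nothing + sum (h ∘ just)
sumList-choices Δ h = cong (λ z → h nothing + z)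
  (trans (sumList-map just (List.allFin (suc Δ)) h) (sumList-tabulate id (h ∘ just)))

prChoice-cong : ∀ Δ {b b′ : Choice Δ → Bool} → (∀ x → b x ≡ b′ x) → prChoice Δ b ≡ prChoice Δ b′
prChoice-cong Δ b≗b′ = sumList-cong (choices Δ) (λ x → cong (λ t → if t then weight Δ x else 0ℚ) (b≗b′ x))

prChoice-true : ∀ Δ → prChoice Δ (λ _ → true) ≡ 1ℚ
prChoice-true Δ = begin
  prChoice Δ (λ _ → true)
    ≡⟨ sumList-choices Δ (weight Δ) ⟩
  + 99 / 100 + sum {suc Δ} (λ _ → pickProb Δ)
    ≡⟨ cong (λ z → + 99 / 100 + z) (sum-if {suc Δ} (λ _ → true) (pickProb Δ)) ⟩
  + 99 / 100 + toℚ (count′ {suc Δ} (λ _ → true)) * pickProb Δ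
    ≡⟨ cong (λ k → + 99 / 100 + toℚ k * pickProb Δ) (count′-true (suc Δ)) ⟩
  + 99 / 100 + toℚ (suc Δ) * pickProb Δ
    ≡⟨ cong (λ z → + 99 / 100 + z) ([1+Δ]*pickProb≡1/100 Δ) ⟩
  1ℚ
    ∎
  where open ≡-Reasoning

prChoice-not : ∀ Δ b → prChoice Δ (λ x → not (b x)) ≡ 1ℚ - prChoice Δ b
prChoice-not Δ b = begin
  q̄
    ≡⟨ solve 2 (λ a s → a := (a :+ s) :- s) refl q̄ q ⟩
  (q̄ + q) - q
    ≡⟨ cong (_- q) (sym (sumList-+ (choices Δ) (λ x → ind (not (b x)) x) (λ x → ind (b x) x))) ⟩
  sumList (choices Δ) (λ x → ind (not (b x)) x + ind (b x) x) - q
    ≡⟨ cong (_- q) (sumList-cong (choices Δ) split) ⟩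
  prChoice Δ (λ _ → true) - q
    ≡⟨ cong (_- q) (prChoice-true Δ) ⟩
  1ℚ - q
    ∎
  where
  q̄ = prChoice Δ (λ x → not (b x))
  q = prChoice Δ b
  open ≡-Reasoning
  ind : Bool → Choice Δ → ℚ
  ind t x = if t then weight Δ x else 0ℚ
  split : ∀ x → ind (not (b x)) x + ind (b x) x ≡ weight Δ x
  split x with b x
  ... | true  = +-identityˡ _
  ... | false = +-identityʳ _

prChoice-∧ : ∀ Δ t b → prChoice Δ (λ x → t ∧ b x) ≡ (if t then prChoice Δ b else 0ℚ)
prChoice-∧ Δ true  b = refl
prChoice-∧ Δ false b = sumList-zero (choices Δ)

allAt : ∀ {n Δ} → (Fin n → Choice Δ → Bool) → Assignment n Δ → Bool
allAt B []      = true
allAt B (x ∷ σ) = B zero x ∧ allAt (B ∘ suc) σ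

allAt-lookup : ∀ {n Δ} (B : Fin n → Choice Δ → Bool) σ → allAt B σ ≡ true → ∀ u → B u (lookup σ u) ≡ true
allAt-lookup B (x ∷ σ) Bσ zero    = ∧-trueˡ Bσ
allAt-lookup B (x ∷ σ) Bσ (suc u) = allAt-lookup (B ∘ suc) σ (∧-trueʳ {B zero x} Bσ) u

if-∧-* : ∀ a b (x y : ℚ) → (if a ∧ b then x * y else 0ℚ) ≡ (if a then x else 0ℚ) * (if b then y else 0ℚ)
if-∧-* true  true  x y = refl
if-∧-* true  false x y = sym (*-zeroʳ x)
if-∧-* false b     x y = sym (*-zeroˡ (if b then y else 0ℚ))

Pr-allAt : ∀ n Δ (B : Fin n → Choice Δ → Bool) → Pr n Δ (allAt B) ≡ prod (λ u → prChoice Δ (B u))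
Pr-allAt zero    Δ B = refl
Pr-allAt (suc n) Δ B = begin
  sumList (concatMap (λ x → List.map (x ∷_) L) cs) g
    ≡⟨ sumList-concatMap (λ x → List.map (x ∷_) L) cs g ⟩
  sumList cs (λ x → sumList (List.map (x ∷_) L) g)
    ≡⟨ sumList-cong cs (λ x → sumList-map (x ∷_) L g) ⟩
  sumList cs (λ x → sumList L (λ τ → g (x ∷ τ)))
    ≡⟨ sumList-cong cs (λ x → sumList-cong L (λ τ → if-∧-* (B zero x) (allAt (B ∘ suc) τ) (weight Δ x) (prob Δ τ))) ⟩
  sumList cs (λ x → sumList L (λ τ → head x * tail τ))
    ≡⟨ sumList-cong cs (λ x → sumList-*ˡ L (head x) tail) ⟩
  sumList cs (λ x → head x * sumList L tail)
    ≡⟨ sumList-*ʳ cs (sumList L tail) head ⟩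
  prChoice Δ (B zero) * Pr n Δ (allAt (B ∘ suc))
    ≡⟨ cong (λ z → prChoice Δ (B zero) * z) (Pr-allAt n Δ (B ∘ suc)) ⟩
  prod (λ u → prChoice Δ (B u))
    ∎
  where
  open ≡-Reasoning
  cs = choices Δ
  L = allVecs cs n
  g : Assignment (suc n) Δ → ℚ
  g σ = if allAt B σ then prob Δ σ else 0ℚ
  head : Choice Δ → ℚ
  head x = if B zero x then weight Δ x else 0ℚ
  tail : Assignment n Δ → ℚ
  tail τ = if allAt (B ∘ suc) τ then prob Δ τ else 0ℚ

Pr-disjoint-≤ : ∀ {n Δ m} (E : Fin m → Assignment n Δ → Bool) (F : Assignment n Δ → Bool) →
                (∀ σ i j → E i σ ≡ true → E j σ ≡ true → i ≡ j) →
                (∀ σ i → E i σ ≡ true → F σ ≡ true) →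
                sum (λ i → Pr n Δ (E i)) ≤ Pr n Δ F
Pr-disjoint-≤ {n} {Δ} E F disjoint E⇒F = begin
  sum (λ i → Pr n Δ (E i))
    ≡⟨ sym (sumList-sum L (λ i σ → if E i σ then prob Δ σ else 0ℚ)) ⟩
  sumList L (λ σ → sum (λ i → if E i σ then prob Δ σ else 0ℚ))
    ≡⟨ sumList-cong L (λ σ → sum-if (λ i → E i σ) (prob Δ σ)) ⟩
  sumList L (λ σ → toℚ (count′ (λ i → E i σ)) * prob Δ σ)
    ≤⟨ sumList-mono-≤ L at-most-one ⟩
  Pr n Δ F
    ∎
  where
  open ≤-Reasoning
  L = allVecs (choices Δ) n
  at-most-one : ∀ σ → toℚ (count′ (λ i → E i σ)) * prob Δ σ ≤ (if F σ then prob Δ σ else 0ℚ)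
  at-most-one σ with F σ in Fσ
  ... | true  = ≤-trans (*-monoʳ-≤-≥0 (prob-nonNeg σ) (toℚ-mono-≤ (count′-≤1 _ (disjoint σ))))
                        (≤-reflexive (*-identityˡ _))
  ... | false = ≤-reflexive (trans (cong (λ k → toℚ k * prob Δ σ) (count′-zero _ none)) (*-zeroˡ (prob Δ σ)))
    where
    none : ∀ i → E i σ ≡ false
    none i with E i σ in Eiσ
    ... | false = refl
    ... | true with () ← trans (sym (E⇒F σ i Eiσ)) Fσ

colourOf : ∀ {n Δ} → Palettes n Δ → Fin n → Choice Δ → ℕ
colourOf Pal u nothing  = 0
colourOf Pal u (just i) = lookup (Pal u) i

Aval≡colourOf : ∀ {n Δ} (Pal : Palettes n Δ) σ u → Aval Pal σ u ≡ colourOf Pal u (lookup σ u)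
Aval≡colourOf Pal σ u with lookup σ u
... | nothing = refl
... | just _  = refl

∈-palette⇒≢0 : ∀ {n Δ} (Pal : Palettes n Δ) {u c} → (∀ i → lookup (Pal u) i ≢ 0) → c ∈ Pal u → c ≢ 0
∈-palette⇒≢0 Pal nonzero c∈ c≡0 = nonzero (Any.index c∈) (trans (sym (lookup-index c∈)) c≡0)

module _ {n Δ} (Pal : Palettes n Δ) (u : Fin n) {c : ℕ} (c≢0 : c ≢ 0) where

  private
    occursAt : Fin (suc Δ) → Bool
    occursAt i = does (lookup (Pal u) i ℕ.≟ c)

    prChoice-colour : prChoice Δ (λ x → does (colourOf Pal u x ℕ.≟ c)) ≡ toℚ (count′ occursAt) * pickProb Δ
    prChoice-colour = begin
      prChoice Δ (λ x → does (colourOf Pal u x ℕ.≟ c))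
        ≡⟨ sumList-choices Δ (λ x → if does (colourOf Pal u x ℕ.≟ c) then weight Δ x else 0ℚ) ⟩
      (if does (0 ℕ.≟ c) then weight Δ nothing else 0ℚ) + S
        ≡⟨ cong (λ t → (if t then weight Δ nothing else 0ℚ) + S) (dec-false (0 ℕ.≟ c) (c≢0 ∘ sym)) ⟩
      0ℚ + S
        ≡⟨ +-identityˡ S ⟩
      S
        ≡⟨ sum-if occursAt (pickProb Δ) ⟩
      toℚ (count′ occursAt) * pickProb Δ
        ∎
      where
      open ≡-Reasoning
      S = sum (λ i → if occursAt i then pickProb Δ else 0ℚ)

  prChoice-colour-≤ : (∀ i j → lookup (Pal u) i ≡ lookup (Pal u) j → i ≡ j) →
                      prChoice Δ (λ x → does (colourOf Pal u x ℕ.≟ c)) ≤ pickProb Δ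
  prChoice-colour-≤ distinct = begin
    prChoice Δ (λ x → does (colourOf Pal u x ℕ.≟ c))
      ≡⟨ prChoice-colour ⟩
    toℚ (count′ occursAt) * p
      ≤⟨ *-monoʳ-≤-≥0 (pickProb-nonNeg Δ) (toℚ-mono-≤ (count′-≤1 occursAt at-most-once)) ⟩
    1ℚ * p
      ≡⟨ *-identityˡ p ⟩
    p
      ∎
    where
    open ≤-Reasoning
    p = pickProb Δ
    at-most-once : ∀ i j → occursAt i ≡ true → occursAt j ≡ true → i ≡ j
    at-most-once i j i↦c j↦c =
      distinct i j (trans (does-true⇒ (lookup (Pal u) i ℕ.≟ c) i↦c) (sym (does-true⇒ (lookup (Pal u) j ℕ.≟ c) j↦c)))

  prChoice-colour-≥ : c ∈ Pal u → pickProb Δ ≤ prChoice Δ (λ x → does (colourOf Pal u x ℕ.≟ c))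
  prChoice-colour-≥ c∈ = begin
    p
      ≡⟨ sym (*-identityˡ p) ⟩
    1ℚ * p
      ≤⟨ *-monoʳ-≤-≥0 (pickProb-nonNeg Δ) (toℚ-mono-≤ (count′-pos occursAt (Any.index c∈) occurs)) ⟩
    toℚ (count′ occursAt) * p
      ≡⟨ sym prChoice-colour ⟩
    prChoice Δ (λ x → does (colourOf Pal u x ℕ.≟ c))
      ∎
    where
    open ≤-Reasoning
    p = pickProb Δ
    occurs : occursAt (Any.index c∈) ≡ true
    occurs = dec-true (lookup (Pal u) (Any.index c∈) ℕ.≟ c) (sym (lookup-index c∈))

neighbour-clashes≡0 : ∀ {n Δ} (G : SimpleGraph n) (Pal : Palettes n Δ) σ w {c} → Aval Pal σ w ≡ c →
                      (∀ u → adj G w u ≡ true → Aval Pal σ u ≢ c) →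
                      count (λ u → adj G w u ∧ does (Aval Pal σ u ℕ.≟ Aval Pal σ w)) ≡ 0
neighbour-clashes≡0 G Pal σ w A≡c nbrs≢c = trans (count≡count′ clash) (count′-zero clash no-clash)
  where
  clash : Fin _ → Bool
  clash u = adj G w u ∧ does (Aval Pal σ u ℕ.≟ Aval Pal σ w)
  no-clash : ∀ u → clash u ≡ false
  no-clash u with adj G w u in wu
  ... | false = refl
  ... | true  = dec-false (Aval Pal σ u ℕ.≟ Aval Pal σ w) (λ same → nbrs≢c u wu (trans same A≡c))

χ≡ : ∀ {n Δ} (G : SimpleGraph n) (Pal : Palettes n Δ) σ w {c} → c ≢ 0 → Aval Pal σ w ≡ c →
     (∀ u → adj G w u ≡ true → Aval Pal σ u ≢ c) → χ G Pal σ w ≡ c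
χ≡ G Pal σ w c≢0 A≡c nbrs≢c with Aval Pal σ w ℕ.≟ 0
... | yes A≡0 = ⊥-elim (c≢0 (trans (sym A≡c) A≡0))
... | no _ rewrite neighbour-clashes≡0 G Pal σ w A≡c nbrs≢c = A≡c

χ≡⇒isGood : ∀ {n Δ} (G : SimpleGraph n) (Pal : Palettes n Δ) σ {v w c} → c ∉ Pal v → c ≢ 0 →
            adj G v w ≡ true → χ G Pal σ w ≡ c → isGood G Pal σ c v ≡ true
χ≡⇒isGood G Pal σ {v} {w} {c} c∉ c≢0 vw χw≡c with c ℕ.≟ 0
... | yes c≡0 = ⊥-elim (c≢0 c≡0)
... | no _ rewrite dec-false (c ∈? Pal v) c∉ =
  dec-true (1 ℕ.≤? _) (subst (1 ℕ.≤_) (sym (count≡count′ keeps-c))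
                             (count′-pos keeps-c w (cong₂ _∧_ vw (dec-true (χ G Pal σ w ℕ.≟ c) χw≡c))))
  where
  keeps-c : Fin _ → Bool
  keeps-c u = adj G v u ∧ does (χ G Pal σ u ℕ.≟ c)

-- Witnesses of a good colour

winProb : ℕ → ℚ
winProb Δ = pickProb Δ * (1ℚ - toℚ (Δ ℕ.+ Δ) * pickProb Δ)

1/1000≤x[1-2x] : ∀ x → + 1 / 200 ≤ x → x ≤ + 1 / 100 → + 1 / 1000 ≤ x * (1ℚ - (x + x))
1/1000≤x[1-2x] x 1/200≤x x≤1/100 = begin
  + 1 / 1000
    ≤⟨ toWitness {a? = + 1 / 1000 ℚ.≤? + 1 / 200 * y} tt ⟩
  + 1 / 200 * y
    ≤⟨ *-monoˡ-≤-≥0 (toWitness {a? = 0ℚ ℚ.≤? + 1 / 200} tt) y≤1-2x ⟩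
  + 1 / 200 * (1ℚ - (x + x))
    ≤⟨ *-monoʳ-≤-≥0 (≤-trans (toWitness {a? = 0ℚ ℚ.≤? y} tt) y≤1-2x) 1/200≤x ⟩
  x * (1ℚ - (x + x))
    ∎
  where
  open ≤-Reasoning
  y = 1ℚ - (+ 1 / 100 + + 1 / 100)
  y≤1-2x : y ≤ 1ℚ - (x + x)
  y≤1-2x = 1-antimono-≤ (+-mono-≤ x≤1/100 x≤1/100)

1/1000≤Δ*winProb : ∀ Δ → 1 ℕ.≤ Δ → + 1 / 1000 ≤ toℚ Δ * winProb Δ
1/1000≤Δ*winProb Δ 1≤Δ = begin
  + 1 / 1000
    ≤⟨ 1/1000≤x[1-2x] x 1/200≤x x≤1/100 ⟩
  x * (1ℚ - (x + x))
    ≡⟨ solve 2 (λ a p → (a :* p) :* (con 1ℚ :- (a :* p :+ a :* p)) := a :* (p :* (con 1ℚ :- (a :+ a) :* p)))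
               refl (toℚ Δ) p ⟩
  toℚ Δ * (p * (1ℚ - (toℚ Δ + toℚ Δ) * p))
    ≡⟨ cong (λ z → toℚ Δ * (p * (1ℚ - z * p))) (sym (toℚ-+ Δ Δ)) ⟩
  toℚ Δ * winProb Δ
    ∎
  where
  open ≤-Reasoning
  p = pickProb Δ
  x = toℚ Δ * p
  x≤1/100 : x ≤ + 1 / 100
  x≤1/100 = ≤-trans (*-monoʳ-≤-≥0 (pickProb-nonNeg Δ) (toℚ-mono-≤ (ℕₚ.n≤1+n Δ)))
                    (≤-reflexive ([1+Δ]*pickProb≡1/100 Δ))
  1/200≤x : + 1 / 200 ≤ x
  1/200≤x = begin
    + 1 / 200                          ≡⟨ cong (+ 1 / 2 *_) (sym ([1+Δ]*pickProb≡1/100 Δ)) ⟩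
    + 1 / 2 * (toℚ (suc Δ) * p)        ≤⟨ *-monoˡ-≤-≥0 (toWitness {a? = 0ℚ ℚ.≤? + 1 / 2} tt)
                                            (*-monoʳ-≤-≥0 (pickProb-nonNeg Δ) (toℚ-mono-≤ (ℕₚ.+-monoˡ-≤ Δ 1≤Δ))) ⟩
    + 1 / 2 * (toℚ (Δ ℕ.+ Δ) * p)      ≡⟨ cong (λ z → + 1 / 2 * (z * p)) (toℚ-+ Δ Δ) ⟩
    + 1 / 2 * ((toℚ Δ + toℚ Δ) * p)    ≡⟨ solve 2 (λ a p → con (+ 1 / 2) :* ((a :+ a) :* p) := a :* p) refl (toℚ Δ) p ⟩
    x                                  ∎

module Witness {n Δ} (G : SimpleGraph n) (Pal : Palettes n Δ) (v : Fin n) (c : ℕ) where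

  proposes : Fin n → Choice Δ → Bool
  proposes u x = does (colourOf Pal u x ℕ.≟ c)

  inNc : Fin n → Bool
  inNc u = adj G v u ∧ inPal Pal c u

  rival : Fin n → Fin n → Bool
  rival w u = inNc u ∨ adj G w u

  -- Winning is a condition on each vertex's own choice, so Pr-allAt turns its probability into a product.
  winsAt : Fin n → Fin n → Choice Δ → Bool
  winsAt w u x = if does (u Fin.≟ w) then proposes u x else not (rival w u ∧ proposes u x)

  Wins : Fin n → Assignment n Δ → Bool
  Wins w σ = inNc w ∧ allAt (winsAt w) σ

  winsAt-self : ∀ w x → winsAt w w x ≡ proposes w x
  winsAt-self w x rewrite dec-true (w Fin.≟ w) refl = refl

  winsAt-other : ∀ w u x → u ≢ w → winsAt w u x ≡ not (rival w u ∧ proposes u x)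
  winsAt-other w u x u≢w rewrite dec-false (u Fin.≟ w) u≢w = refl

  winsAt-lookup : ∀ w σ → Wins w σ ≡ true → ∀ u → winsAt w u (lookup σ u) ≡ true
  winsAt-lookup w σ wins = allAt-lookup (winsAt w) σ (∧-trueʳ {inNc w} wins)

  Wins⇒A≡c : ∀ w σ → Wins w σ ≡ true → Aval Pal σ w ≡ c
  Wins⇒A≡c w σ wins = trans (Aval≡colourOf Pal σ w)
    (does-true⇒ (colourOf Pal w (lookup σ w) ℕ.≟ c) (trans (sym (winsAt-self w (lookup σ w))) (winsAt-lookup w σ wins w)))

  Wins⇒rival-A≢c : ∀ w σ u → Wins w σ ≡ true → u ≢ w → rival w u ≡ true → Aval Pal σ u ≢ c
  Wins⇒rival-A≢c w σ u wins u≢w rival-u A≡c =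
    does-false⇒ (colourOf Pal u x ℕ.≟ c) silent (trans (sym (Aval≡colourOf Pal σ u)) A≡c)
    where
    x = lookup σ u
    silent : proposes u x ≡ false
    silent = not-injective (subst (λ r → not (r ∧ proposes u x) ≡ true) rival-u
               (trans (sym (winsAt-other w u x u≢w)) (winsAt-lookup w σ wins u)))

  Wins-disjoint : ∀ σ w w′ → Wins w σ ≡ true → Wins w′ σ ≡ true → w ≡ w′
  Wins-disjoint σ w w′ wins wins′ with w′ Fin.≟ w
  ... | yes w′≡w = sym w′≡w
  ... | no  w′≢w =
    ⊥-elim (Wins⇒rival-A≢c w σ w′ wins w′≢w (cong (_∨ adj G w w′) (∧-trueˡ wins′)) (Wins⇒A≡c w′ σ wins′))

  module _ (nonzero : ∀ u i → lookup (Pal u) i ≢ 0) where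

    c∈Pal : ∀ {w} → inNc w ≡ true → c ∈ Pal w
    c∈Pal {w} w∈Nc = does-true⇒ (c ∈? Pal w) (∧-trueʳ {adj G v w} w∈Nc)

    Wins⇒isGood : c ∉ Pal v → ∀ σ w → Wins w σ ≡ true → isGood G Pal σ c v ≡ true
    Wins⇒isGood c∉ σ w wins =
      χ≡⇒isGood G Pal σ c∉ c≢0 (∧-trueˡ (∧-trueˡ wins)) (χ≡ G Pal σ w c≢0 (Wins⇒A≡c w σ wins) neighbours-silent)
      where
      c≢0 = ∈-palette⇒≢0 Pal (nonzero w) (c∈Pal (∧-trueˡ wins))
      neighbours-silent : ∀ u → adj G w u ≡ true → Aval Pal σ u ≢ c
      neighbours-silent u wu = Wins⇒rival-A≢c w σ u wins (λ { refl → case trans (sym wu) (loopless G u) of λ () })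
                                                         (trans (cong (inNc u ∨_) wu) (∨-zeroʳ _))

    module _ (distinct : ∀ u i j → lookup (Pal u) i ≡ lookup (Pal u) j → i ≡ j) (maxDeg : maxDegree G ≡ Δ) where

      count-rival-≤ : ∀ w → count′ (rival w) ℕ.≤ Δ ℕ.+ Δ
      count-rival-≤ w = ℕₚ.≤-trans (count′-∨ inNc (adj G w))
        (ℕₚ.+-mono-≤ (ℕₚ.≤-trans (count′-mono inNc (adj G v) (λ u → ∧-trueˡ)) (degree-≤ v)) (degree-≤ w))
        where
        degree-≤ : ∀ u → count′ (adj G u) ℕ.≤ Δ
        degree-≤ u = subst₂ ℕ._≤_ (count≡count′ (adj G u)) maxDeg (degree≤maxDegree G u)

      prChoice-winsAt-self-≥ : ∀ w → inNc w ≡ true → pickProb Δ ≤ prChoice Δ (winsAt w w)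
      prChoice-winsAt-self-≥ w w∈Nc = subst (pickProb Δ ≤_) (prChoice-cong Δ (λ x → sym (winsAt-self w x)))
        (prChoice-colour-≥ Pal w (∈-palette⇒≢0 Pal (nonzero w) (c∈Pal w∈Nc)) (c∈Pal w∈Nc))

      prChoice-winsAt-other-≥ : c ≢ 0 → ∀ w u → u ≢ w →
                                1ℚ - (if rival w u then pickProb Δ else 0ℚ) ≤ prChoice Δ (winsAt w u)
      prChoice-winsAt-other-≥ c≢0 w u u≢w = begin
        1ℚ - collision
          ≤⟨ 1-antimono-≤ (subst (_≤ collision) (sym (prChoice-∧ Δ (rival w u) (proposes u))) (colliding-≤ (rival w u))) ⟩
        1ℚ - prChoice Δ (λ x → rival w u ∧ proposes u x)
          ≡⟨ sym (prChoice-not Δ (λ x → rival w u ∧ proposes u x)) ⟩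
        prChoice Δ (λ x → not (rival w u ∧ proposes u x))
          ≡⟨ prChoice-cong Δ (λ x → sym (winsAt-other w u x u≢w)) ⟩
        prChoice Δ (winsAt w u)
          ∎
        where
        open ≤-Reasoning
        collision = if rival w u then pickProb Δ else 0ℚ
        colliding-≤ : ∀ t → (if t then prChoice Δ (proposes u) else 0ℚ) ≤ (if t then pickProb Δ else 0ℚ)
        colliding-≤ true  = prChoice-colour-≤ Pal u c≢0 (distinct u)
        colliding-≤ false = ≤-refl

      Pr-Wins-≥ : ∀ w → inNc w ≡ true → winProb Δ ≤ Pr n Δ (Wins w)
      Pr-Wins-≥ w w∈Nc = begin
        p * (1ℚ - toℚ (Δ ℕ.+ Δ) * p)
          ≤⟨ *-monoˡ-≤-≥0 (pickProb-nonNeg Δ)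
                          (1-antimono-≤ (*-monoʳ-≤-≥0 (pickProb-nonNeg Δ) (toℚ-mono-≤ (count-rival-≤ w)))) ⟩
        p * (1ℚ - toℚ (count′ (rival w)) * p)
          ≡⟨ cong (λ z → p * (1ℚ - z)) (sym (sum-if (rival w) p)) ⟩
        p * (1ℚ - sum collision)
          ≤⟨ p*[1-sum]≤prod p collision (λ u → prChoice Δ (winsAt w u)) w
                            (pickProb-nonNeg Δ) (prChoice-winsAt-self-≥ w w∈Nc)
                            (λ u → if-nonNeg (rival w u)) (λ u → if-≤1 (rival w u))
                            (prChoice-winsAt-other-≥ (∈-palette⇒≢0 Pal (nonzero w) (c∈Pal w∈Nc)) w) ⟩
        prod (λ u → prChoice Δ (winsAt w u))
          ≡⟨ sym (Pr-allAt n Δ (winsAt w)) ⟩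
        Pr n Δ (allAt (winsAt w))
          ≡⟨ cong (λ t → Pr n Δ (λ σ → t ∧ allAt (winsAt w) σ)) (sym w∈Nc) ⟩
        Pr n Δ (Wins w)
          ∎
        where
        open ≤-Reasoning
        p = pickProb Δ
        collision : Fin n → ℚ
        collision u = if rival w u then p else 0ℚ
        if-nonNeg : ∀ t → 0ℚ ≤ (if t then p else 0ℚ)
        if-nonNeg true  = pickProb-nonNeg Δ
        if-nonNeg false = ≤-refl
        if-≤1 : ∀ t → (if t then p else 0ℚ) ≤ 1ℚ
        if-≤1 true  = pickProb≤1 Δ
        if-≤1 false = ℚ.*≤* (ℤ.+≤+ ℕ.z≤n)

      Pr-isGood-≥ : c ∉ Pal v → toℚ (Nc G Pal c v) * winProb Δ ≤ Pr n Δ (λ σ → isGood G Pal σ c v)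
      Pr-isGood-≥ c∉ = begin
        toℚ (Nc G Pal c v) * winProb Δ                ≡⟨ cong (λ k → toℚ k * winProb Δ) (count≡count′ inNc) ⟩
        toℚ (count′ inNc) * winProb Δ                 ≡⟨ sym (sum-if inNc (winProb Δ)) ⟩
        sum (λ w → if inNc w then winProb Δ else 0ℚ)  ≤⟨ sum-mono-≤ Wins-bound ⟩
        sum (λ w → Pr n Δ (Wins w))                   ≤⟨ Pr-disjoint-≤ Wins _ Wins-disjoint (Wins⇒isGood c∉) ⟩
        Pr n Δ (λ σ → isGood G Pal σ c v)             ∎
        where
        open ≤-Reasoning
        Wins-bound : ∀ w → (if inNc w then winProb Δ else 0ℚ) ≤ Pr n Δ (Wins w)
        Wins-bound w = if-≤ (inNc w) (Pr-Wins-≥ w) (Pr-nonNeg n Δ (Wins w))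

mainTheorem10 : ∃ λ (c : ℚ) → 0ℚ < c ×
    (∀ (ε : ℚ) → 0ℚ < ε → ε < + 1 / 5 →
     ∀ (n Δ : ℕ) (G : SimpleGraph n) → maxDegree G ≡ Δ → 1 ℕ.≤ Δ →
     ∀ (Pal : Palettes n Δ) →
     (∀ v i j → lookup (Pal v) i ≡ lookup (Pal v) j → i ≡ j) →
     (∀ v i → lookup (Pal v) i ≢ 0) →
     ∀ (v : Fin n) → Sparse G Δ ε v →
     ∀ (c' : ℕ) → c' ∉ Pal v →
     c * toℚ (Nc G Pal c' v)
       ≤ toℚ Δ * Pr n Δ (λ σ → isGood G Pal σ c' v))
mainTheorem10 = + 1 / 1000 , toWitness {a? = 0ℚ ℚ.<? + 1 / 1000} tt ,
  λ _ _ _ n Δ G maxDeg 1≤Δ Pal distinct nonzero v _ c′ c′∉ →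
    let open ≤-Reasoning
        K = toℚ (Nc G Pal c′ v)
    in begin
      + 1 / 1000 * K
        ≡⟨ *-comm _ K ⟩
      K * (+ 1 / 1000)
        ≤⟨ *-monoˡ-≤-≥0 (toℚ-nonNeg (Nc G Pal c′ v)) (1/1000≤Δ*winProb Δ 1≤Δ) ⟩
      K * (toℚ Δ * winProb Δ)
        ≡⟨ solve 3 (λ k d q → k :* (d :* q) := d :* (k :* q)) refl K (toℚ Δ) (winProb Δ) ⟩
      toℚ Δ * (K * winProb Δ)
        ≤⟨ *-monoˡ-≤-≥0 (toℚ-nonNeg Δ) (Witness.Pr-isGood-≥ G Pal v c′ nonzero distinct maxDeg c′∉) ⟩
      toℚ Δ * Pr n Δ (λ σ → isGood G Pal σ c′ v)
        ∎
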